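{- Let $n\ge3$ and $r,k$ be integers with $2\le k\le r+1$ and $r\le n$. Then \[ {\rm ex}(n,H_k^r) \geq \frac{1}{n}\sum_{d=0}^{\lfloor (k-2)n/r\rfloor} N(n,r,k-1,d). \]
   Context: Identify the vertices of the oriented cycle $C_n$ with $\mathbb{Z}_n$, with arcs $(x,x+1)$. For nonempty $B\subseteq\mathbb{Z}_n$, $d(B)$ is the least $\ell\ge0$ such that $B\subseteq\{x,x+1,\dots,x+\ell\}$ (mod $n$) for some $x\in B$ (the length of the shortest directed path through all elements of $B$). For $t\le|A|$, $d_t(A)=\min\{d(B):B\subseteq A,|B|=t\}$. $N(n,r,t,d)$ is the number of $r$-element subsets $A\subseteq\mathbb{Z}_n$ with $d_t(A)\ge d$. $H_k^r$ is the $r$-graph with $r+1$ vertices and $k$ edges; ${\rm ex}(n,H)$ is the maximum number of edges in an $r$-graph on $n$ vertices with no subgraph isomorphic to $H$. -}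

module Defs where

open import Data.Bool using (Bool; true; false; if_then_else_; _∧_)
open import Data.Nat using (ℕ; zero; suc; _+_; _∸_; _≤ᵇ_; _<ᵇ_; _⊓_; _≟_)
open import Data.Fin using (Fin; toℕ)
open import Data.List using (List; []; _∷_; map; _++_; filter; length; foldr; allFin)
open import Data.Bool.ListAction using (any)
open import Data.Vec using (Vec; []; _∷_; tabulate; toList)
open import Data.Vec.Properties using (≡-dec)
import Data.Bool as B
open import Data.Fin.Subset using (Subset; ∣_∣; ⁅_⁆; ∁; ⋃)
open import Data.Fin.Subset.Properties using (_⊆?_)
open import Data.Product using (∃; _×_)
open import Function.Definitions using (Injective)
open import Relation.Binary.PropositionalEquality using (_≡_)
open import Relation.Nullary using (does; ¬_)
open import Relation.Nullary.Decidable using (_×-dec_)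

allSubsets : (n : ℕ) → List (Subset n)
allSubsets zero = [] ∷ []
allSubsets (suc n) = map (true ∷_) (allSubsets n) ++ map (false ∷_) (allSubsets n)

elems : {n : ℕ} → Subset n → List (Fin n)
elems {n} B = filter (λ x → Data.Vec.lookup B x B.≟ true) (allFin n)

-- The oriented cycle C_n on Z_n = Fin n, arcs (x, x+1 mod n)

-- (v - x) mod n, i.e. the length of the directed path from x to v
offset : (n : ℕ) → Fin n → Fin n → ℕ
offset n x v = if toℕ x ≤ᵇ toℕ v then toℕ v ∸ toℕ x else (toℕ v + n) ∸ toℕ x

interval : {n : ℕ} → Fin n → ℕ → Subset n
interval {n} x ℓ = tabulate (λ v → offset n x v ≤ᵇ ℓ)

-- least m' < m with p m', or m if there is none
least : (ℕ → Bool) → ℕ → ℕ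
least p zero = zero
least p (suc m) = if p zero then zero else suc (least (λ i → p (suc i)) m)

fits : {n : ℕ} → Subset n → ℕ → Bool
fits B ℓ = any (λ x → does (B ⊆? interval x ℓ)) (elems B)

-- d(B): least ℓ ≥ 0 with B ⊆ {x,...,x+ℓ} for some x ∈ B.
-- For nonempty B such ℓ ≤ n-1 always exists, so searching ℓ < n suffices.
dist : {n : ℕ} → Subset n → ℕ
dist {n} B = least (fits B) n

-- d_t(A) = min { d(B) : B ⊆ A, |B| = t }   (for t ≤ |A|; the list is then
-- nonempty and every d(B) ≤ n-1 < n, so the start value n is never attained)
distT : {n : ℕ} → ℕ → Subset n → ℕ
distT {n} t A =
  foldr (λ B m → dist B ⊓ m) n
    (filter (λ B → (B ⊆? A) ×-dec (∣ B ∣ ≟ t)) (allSubsets n))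

N : ℕ → ℕ → ℕ → ℕ → ℕ
N n r t d = length (filter (λ A → (∣ A ∣ ≟ r) ×-dec (Data.Nat._≤?_ d (distT t A))) (allSubsets n))

record RGraph (n r : ℕ) : Set where
  field
    edge    : Subset n → Bool
    uniform : ∀ e → edge e ≡ true → ∣ e ∣ ≡ r
open RGraph public

numEdges : {n r : ℕ} → RGraph n r → ℕ
numEdges {n} G = length (filter (λ e → edge G e B.≟ true) (allSubsets n))

image : {m n : ℕ} → (Fin m → Fin n) → Subset m → Subset n
image f e = ⋃ (map (λ j → ⁅ f j ⁆) (elems e))

Contains : {m n r : ℕ} → RGraph n r → (Subset m → Bool) → Set
Contains {m} {n} G H =
  ∃ λ (f : Fin m → Fin n) → Injective _≡_ _≡_ f ×
    (∀ e → H e ≡ true → edge G (image f e) ≡ true)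

-- H_k^r: vertex set Fin (r+1), edges = the complements of the singletons
-- {i} with i < k, i.e. k of the r+1 r-subsets (all such choices are isomorphic).
H-edge : (r k : ℕ) → Subset (suc r) → Bool
H-edge r k e = any (λ i → (toℕ i <ᵇ k) ∧ does (≡-dec B._≟_ e (∁ ⁅ i ⁆))) (allFin (suc r))

-- For c ∈ Z_n let G c be the r-graph whose edges are the r-sets A with (ΣA + c) mod n ≤ d_{k-1}(A).
-- As c runs over Z_n, (ΣA + c) mod n runs over Z_n, so A is an edge of at least
-- #{d ≤ q : d ≤ d_{k-1}(A)} of the graphs for every q < n; summing over A and taking the largest
-- G c gives the bound.  No G c contains H_k^r: if f embeds it, the edges E_j = f(V ∖ {j}), j < k,
-- have ΣE_j = Σf(V) − f(j), so (ΣE_j + c) mod n is the distance from f(j) to the common point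
-- P = (Σf(V) + c) mod n.  If j* maximises this distance D, the k − 1 points f(j), j < k, j ≠ j*,
-- lie in E_{j*} and strictly less than D steps before P, hence on a path of length less than D,
-- contradicting D ≤ d_{k-1}(E_{j*}).

module Submission where

open import Defs
open import Data.Bool using (Bool; true; false; if_then_else_; _∧_; T)
import Data.Bool as Bool
open import Data.Bool.Properties using (T-≡; T-∧)
open import Data.Empty using (⊥-elim)
open import Data.Fin using (Fin; toℕ; fromℕ<) renaming (zero to fzero; suc to fsuc)
open import Data.Fin.Properties using (toℕ<n; toℕ-injective; toℕ-fromℕ<)
import Data.Fin.Properties as Fin
open import Data.Fin.Subset using (Subset; _∈_; _∉_; _⊆_; _∪_; _-_; ⁅_⁆; ∁; ⊤; ∣_∣; ⋃; Nonempty)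
open import Data.Fin.Subset.Properties
open import Data.List using (List; []; _∷_; map; filter; length; foldr; allFin; upTo; applyUpTo; tabulate)
open import Data.List.Extrema.Nat using (argmax; argmax-sel; f[xs]≤f[argmax])
open import Data.List.Membership.Propositional using (lose) renaming (_∈_ to _∈ˡ_)
open import Data.List.Membership.Propositional.Properties using (∈-allFin; ∈-filter⁺; ∈-filter⁻; ∈-map⁺; ∈-map⁻; ∈-++⁺ˡ; ∈-++⁺ʳ)
open import Data.List.Properties using (map-cong; map-tabulate; length-tabulate)
import Data.List.Relation.Unary.All as All
open import Data.List.Relation.Unary.Any using (here; there)
open import Data.List.Relation.Unary.Any.Properties using (any⁺)
open import Data.Nat using (ℕ; zero; suc; _+_; _*_; _∸_; _≤_; _<_; z≤n; s≤s; z<s; _≤ᵇ_; _<ᵇ_; _≡ᵇ_; _⊓_; NonZero; _≟_; _≤?_)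
open import Data.Nat.DivMod using (_/_; _%_; _mod_; m%n<n; m%n≤n; m<n⇒m%n≡m; [m+n]%n≡m%n; %-distribˡ-+; m%n%n≡m%n; m<n*o⇒m/o<n)
open import Data.Nat.ListAction using (sum)
open import Data.Nat.Properties
open import Algebra.Properties.CommutativeSemigroup +-commutativeSemigroup using (interchange; xy∙z≈xz∙y)
open import Data.Product using (∃; _×_; _,_; proj₁; proj₂)
open import Data.Sum using (inj₁; inj₂)
open import Data.Vec using ([]; _∷_; here; there)
import Data.Vec as Vec
open import Data.Vec.Properties using (≡-dec; []=⇒lookup; lookup⇒[]=; lookup∘tabulate)
open import Function using (_∘_; Equivalence)
open import Function.Definitions using (Injective)
open import Relation.Binary.PropositionalEquality
open import Relation.Nullary using (does; yes; no; ¬_; contradiction)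
open import Relation.Nullary.Decidable using (_×-dec_; dec-true)
open import Relation.Unary using (Decidable)

indicator : Bool → ℕ
indicator b = if b then 1 else 0

sum-map-+ : ∀ {A : Set} (f g : A → ℕ) xs →
            sum (map (λ x → f x + g x) xs) ≡ sum (map f xs) + sum (map g xs)
sum-map-+ f g [] = refl
sum-map-+ f g (x ∷ xs) = trans (cong (f x + g x +_) (sum-map-+ f g xs)) (interchange (f x) (g x) _ _)

sum-zeros : ∀ {A : Set} (xs : List A) → sum (map (λ _ → 0) xs) ≡ 0
sum-zeros [] = refl
sum-zeros (_ ∷ xs) = sum-zeros xs

sum-swap : ∀ {A B : Set} (h : A → B → ℕ) xs ys →
           sum (map (λ x → sum (map (h x) ys)) xs) ≡ sum (map (λ y → sum (map (λ x → h x y) xs)) ys)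
sum-swap h [] ys = sym (sum-zeros ys)
sum-swap h (x ∷ xs) ys =
  trans (cong (sum (map (h x) ys) +_) (sum-swap h xs ys)) (sym (sum-map-+ (h x) _ ys))

sum-mono-≤ : ∀ {A : Set} {f g : A → ℕ} → (∀ x → f x ≤ g x) → ∀ xs → sum (map f xs) ≤ sum (map g xs)
sum-mono-≤ f≤g [] = z≤n
sum-mono-≤ f≤g (x ∷ xs) = +-mono-≤ (f≤g x) (sum-mono-≤ f≤g xs)

sum-cong : ∀ {A : Set} {f g : A → ℕ} → (∀ x → f x ≡ g x) → ∀ xs → sum (map f xs) ≡ sum (map g xs)
sum-cong f≗g xs = cong sum (map-cong f≗g xs)

sum≤length*bound : ∀ {A : Set} {f : A → ℕ} {b} xs → (∀ x → f x ≤ b) → sum (map f xs) ≤ length xs * b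
sum≤length*bound [] f≤b = z≤n
sum≤length*bound (x ∷ xs) f≤b = +-mono-≤ (f≤b x) (sum≤length*bound xs f≤b)

length-filter≡sum-indicator : ∀ {A : Set} {P : A → Set} (P? : Decidable P) xs →
                              length (filter P? xs) ≡ sum (map (indicator ∘ does ∘ P?) xs)
length-filter≡sum-indicator P? [] = refl
length-filter≡sum-indicator P? (x ∷ xs) with does (P? x)
... | true = cong suc (length-filter≡sum-indicator P? xs)
... | false = length-filter≡sum-indicator P? xs

sumBelow : ℕ → (ℕ → ℕ) → ℕ
sumBelow zero F = 0
sumBelow (suc m) F = F 0 + sumBelow m (F ∘ suc)

sum-applyUpTo : ∀ (F g : ℕ → ℕ) m → sum (map F (applyUpTo g m)) ≡ sumBelow m (F ∘ g)
sum-applyUpTo F g zero = refl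
sum-applyUpTo F g (suc m) = cong (F (g 0) +_) (sum-applyUpTo F (g ∘ suc) m)

sum-upTo : ∀ (F : ℕ → ℕ) m → sum (map F (upTo m)) ≡ sumBelow m F
sum-upTo F = sum-applyUpTo F (λ x → x)

sum-allFin : ∀ (F : ℕ → ℕ) m → sum (map (F ∘ toℕ) (allFin m)) ≡ sumBelow m F
sum-allFin F m = trans (cong sum (map-tabulate {n = m} (λ x → x) (F ∘ toℕ))) (sum-tabulate F m)
  where
  sum-tabulate : ∀ (F : ℕ → ℕ) m → sum (tabulate {n = m} (F ∘ toℕ)) ≡ sumBelow m F
  sum-tabulate F zero = refl
  sum-tabulate F (suc m) = cong (F 0 +_) (sum-tabulate (F ∘ suc) m)

sumBelow-suc : ∀ m F → sumBelow (suc m) F ≡ sumBelow m F + F m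
sumBelow-suc zero F = +-comm (F 0) 0
sumBelow-suc (suc m) F = trans (cong (F 0 +_) (sumBelow-suc m (F ∘ suc))) (sym (+-assoc (F 0) _ _))

sumBelow-cong : ∀ m {F G} → (∀ x → x < m → F x ≡ G x) → sumBelow m F ≡ sumBelow m G
sumBelow-cong zero F≗G = refl
sumBelow-cong (suc m) F≗G = cong₂ _+_ (F≗G 0 z<s) (sumBelow-cong m (λ x x<m → F≗G (suc x) (s≤s x<m)))

sumBelow-monoˡ-≤ : ∀ {m m′} F → m ≤ m′ → sumBelow m F ≤ sumBelow m′ F
sumBelow-monoˡ-≤ F z≤n = z≤n
sumBelow-monoˡ-≤ F (s≤s m≤m′) = +-monoʳ-≤ (F 0) (sumBelow-monoˡ-≤ (F ∘ suc) m≤m′)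

sumBelow-periodic : ∀ m F → (∀ x → F (x + m) ≡ F x) → ∀ s → sumBelow m (λ x → F (s + x)) ≡ sumBelow m F
sumBelow-periodic m F periodic zero = refl
sumBelow-periodic m F periodic (suc s) = trans (+-cancelˡ-≡ (F s) _ _ step) (sumBelow-periodic m F periodic s)
  where
  open ≡-Reasoning
  step : F s + sumBelow m (λ x → F (suc s + x)) ≡ F s + sumBelow m (λ x → F (s + x))
  step = begin
    F s + sumBelow m (λ x → F (suc s + x))     ≡⟨ cong₂ _+_ (cong F (sym (+-identityʳ s))) (sumBelow-cong m (λ x _ → cong F (sym (+-suc s x)))) ⟩
    sumBelow (suc m) (λ x → F (s + x))         ≡⟨ sumBelow-suc m (λ x → F (s + x)) ⟩
    sumBelow m (λ x → F (s + x)) + F (s + m)   ≡⟨ cong (sumBelow m (λ x → F (s + x)) +_) (periodic s) ⟩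
    sumBelow m (λ x → F (s + x)) + F s         ≡⟨ +-comm _ (F s) ⟩
    F s + sumBelow m (λ x → F (s + x))         ∎

-- Distances on the oriented cycle

%-absorbʳ-+ : ∀ m o d .{{_ : NonZero d}} → (m + o % d) % d ≡ (m + o) % d
%-absorbʳ-+ m o d = begin
  (m + o % d) % d          ≡⟨ %-distribˡ-+ m (o % d) d ⟩
  (m % d + o % d % d) % d  ≡⟨ cong (λ z → (m % d + z) % d) (m%n%n≡m%n o d) ⟩
  (m % d + o % d) % d      ≡⟨ %-distribˡ-+ m o d ⟨
  (m + o) % d              ∎
  where open ≡-Reasoning

%-absorbˡ-+ : ∀ m o d .{{_ : NonZero d}} → (m % d + o) % d ≡ (m + o) % d
%-absorbˡ-+ m o d = begin
  (m % d + o) % d  ≡⟨ cong (_% d) (+-comm (m % d) o) ⟩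
  (o + m % d) % d  ≡⟨ %-absorbʳ-+ o m d ⟩
  (o + m) % d      ≡⟨ cong (_% d) (+-comm o m) ⟩
  (m + o) % d      ∎
  where open ≡-Reasoning

+-cancelˡ-% : ∀ a {u w} d .{{_ : NonZero d}} → u < d → w < d → (a + u) % d ≡ (a + w) % d → u ≡ w
+-cancelˡ-% a d u<d w<d eq = trans (sym (undo u<d)) (trans (cong (λ z → (d ∸ a % d + z) % d) eq) (undo w<d))
  where
  open ≡-Reasoning
  -- adding d ∸ a % d undoes adding a, modulo d
  undo : ∀ {u} → u < d → (d ∸ a % d + (a + u) % d) % d ≡ u
  undo {u} u<d = begin
    (d ∸ a % d + (a + u) % d) % d    ≡⟨ cong (λ z → (d ∸ a % d + z) % d) (%-absorbˡ-+ a u d) ⟨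
    (d ∸ a % d + (a % d + u) % d) % d ≡⟨ %-absorbʳ-+ (d ∸ a % d) (a % d + u) d ⟩
    (d ∸ a % d + (a % d + u)) % d    ≡⟨ cong (_% d) (+-assoc (d ∸ a % d) (a % d) u) ⟨
    (d ∸ a % d + a % d + u) % d      ≡⟨ cong (λ z → (z + u) % d) (m∸n+n≡m (m%n≤n a d)) ⟩
    (d + u) % d                      ≡⟨ cong (_% d) (+-comm d u) ⟩
    (u + d) % d                      ≡⟨ [m+n]%n≡m%n u d ⟩
    u % d                            ≡⟨ m<n⇒m%n≡m u<d ⟩
    u                                ∎

module _ {n : ℕ} .{{_ : NonZero n}} where

  private
    x≤v+n : (x v : Fin n) → toℕ x ≤ toℕ v + n
    x≤v+n x v = ≤-trans (<⇒≤ (toℕ<n x)) (m≤n+m n (toℕ v))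

  offset-< : (x v : Fin n) → offset n x v < n
  offset-< x v with toℕ x ≤ᵇ toℕ v in x≤ᵇv
  ... | true = ≤-<-trans (m∸n≤m (toℕ v) (toℕ x)) (toℕ<n v)
  ... | false = +-cancelˡ-< (toℕ x) _ _ (begin-strict
      toℕ x + (toℕ v + n ∸ toℕ x)  ≡⟨ m+[n∸m]≡n (x≤v+n x v) ⟩
      toℕ v + n                    <⟨ +-monoˡ-< n v<x ⟩
      toℕ x + n                    ∎)
    where
    open ≤-Reasoning
    v<x : toℕ v < toℕ x
    v<x = ≰⇒> (λ x≤v → subst T x≤ᵇv (≤⇒≤ᵇ x≤v))

  offset-correct : (x v : Fin n) → (toℕ x + offset n x v) % n ≡ toℕ v
  offset-correct x v with toℕ x ≤ᵇ toℕ v in x≤ᵇv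
  ... | true = trans (cong (_% n) (m+[n∸m]≡n (≤ᵇ⇒≤ (toℕ x) (toℕ v) (subst T (sym x≤ᵇv) _)))) (m<n⇒m%n≡m (toℕ<n v))
  ... | false = begin
      (toℕ x + (toℕ v + n ∸ toℕ x)) % n  ≡⟨ cong (_% n) (m+[n∸m]≡n (x≤v+n x v)) ⟩
      (toℕ v + n) % n                    ≡⟨ [m+n]%n≡m%n (toℕ v) n ⟩
      toℕ v % n                          ≡⟨ m<n⇒m%n≡m (toℕ<n v) ⟩
      toℕ v                              ∎
    where open ≡-Reasoning

  offset-unique : ∀ (x v : Fin n) {u} → u < n → (toℕ x + u) % n ≡ toℕ v → offset n x v ≡ u
  offset-unique x v u<n eq = +-cancelˡ-% (toℕ x) n (offset-< x v) u<n (trans (offset-correct x v) (sym eq))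

  offset-injectiveˡ : ∀ {x y} (v : Fin n) → offset n x v ≡ offset n y v → x ≡ y
  offset-injectiveˡ {x} {y} v eq = toℕ-injective (+-cancelˡ-% (offset n x v) n (toℕ<n x) (toℕ<n y) (begin
    (offset n x v + toℕ x) % n  ≡⟨ cong (_% n) (+-comm (offset n x v) (toℕ x)) ⟩
    (toℕ x + offset n x v) % n  ≡⟨ offset-correct x v ⟩
    toℕ v                       ≡⟨ offset-correct y v ⟨
    (toℕ y + offset n y v) % n  ≡⟨ cong (λ o → (toℕ y + o) % n) eq ⟨
    (toℕ y + offset n x v) % n  ≡⟨ cong (_% n) (+-comm (toℕ y) (offset n x v)) ⟩
    (offset n x v + toℕ y) % n  ∎))
    where open ≡-Reasoning

  offset-mod : ∀ z (x : Fin n) → offset n x ((z + toℕ x) mod n) ≡ z % n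
  offset-mod z x = offset-unique x ((z + toℕ x) mod n) (m%n<n z n) (begin
    (toℕ x + z % n) % n  ≡⟨ %-absorbʳ-+ (toℕ x) z n ⟩
    (toℕ x + z) % n      ≡⟨ cong (_% n) (+-comm (toℕ x) z) ⟩
    (z + toℕ x) % n      ≡⟨ toℕ-fromℕ< (m%n<n (z + toℕ x) n) ⟨
    toℕ ((z + toℕ x) mod n) ∎)
    where open ≡-Reasoning

  offset-between : ∀ (x y v : Fin n) → offset n y v ≤ offset n x v → offset n x y ≤ offset n x v
  offset-between x y v s≤w with offset n x y ≤? offset n x v
  ... | yes u≤w = u≤w
  ... | no u≰w = contradiction t≡0 (>⇒≢ 0<t)
    where
    u = offset n x y
    w = offset n x v
    s = offset n y v
    w<u : w < u
    w<u = ≰⇒> u≰w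
    t = u ∸ w + s
    0<t : 0 < t
    0<t = ≤-trans (m<n⇒0<n∸m w<u) (m≤m+n (u ∸ w) s)
    t<n : t < n
    t<n = begin-strict
      u ∸ w + s  ≤⟨ +-monoʳ-≤ (u ∸ w) s≤w ⟩
      u ∸ w + w  ≡⟨ m∸n+n≡m (<⇒≤ w<u) ⟩
      u          <⟨ offset-< x y ⟩
      n          ∎
      where open ≤-Reasoning
    t≡0 : t ≡ 0
    t≡0 = +-cancelˡ-% (toℕ x + w) n t<n (≤-<-trans z≤n t<n) (begin
      (toℕ x + w + t) % n            ≡⟨ cong (_% n) path ⟩
      (toℕ x + u + s) % n            ≡⟨ %-absorbˡ-+ (toℕ x + u) s n ⟨
      ((toℕ x + u) % n + s) % n      ≡⟨ cong (λ z → (z + s) % n) (offset-correct x y) ⟩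
      (toℕ y + s) % n                ≡⟨ offset-correct y v ⟩
      toℕ v                          ≡⟨ offset-correct x v ⟨
      (toℕ x + w) % n                ≡⟨ cong (_% n) (+-identityʳ (toℕ x + w)) ⟨
      (toℕ x + w + 0) % n            ∎)
      where
      open ≡-Reasoning
      path : toℕ x + w + t ≡ toℕ x + u + s
      path = begin
        toℕ x + w + (u ∸ w + s)    ≡⟨ +-assoc (toℕ x) w (u ∸ w + s) ⟩
        toℕ x + (w + (u ∸ w + s))  ≡⟨ cong (toℕ x +_) (+-assoc w (u ∸ w) s) ⟨
        toℕ x + (w + (u ∸ w) + s)  ≡⟨ cong (λ z → toℕ x + (z + s)) (m+[n∸m]≡n (<⇒≤ w<u)) ⟩
        toℕ x + (u + s)            ≡⟨ +-assoc (toℕ x) u s ⟨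
        toℕ x + u + s              ∎

∈-tabulate⁺ : ∀ {n} (g : Fin n → Bool) {x} → T (g x) → x ∈ Vec.tabulate g
∈-tabulate⁺ g {x} gx = lookup⇒[]= x _ (trans (lookup∘tabulate g x) (Equivalence.to T-≡ gx))

∈-tabulate⁻ : ∀ {n} (g : Fin n → Bool) {x} → x ∈ Vec.tabulate g → T (g x)
∈-tabulate⁻ g {x} x∈ = Equivalence.from T-≡ (trans (sym (lookup∘tabulate g x)) ([]=⇒lookup x∈))

elems⁺ : ∀ {n} {p : Subset n} {x} → x ∈ p → x ∈ˡ elems p
elems⁺ {p = p} {x} x∈p = ∈-filter⁺ (λ y → Vec.lookup p y Bool.≟ true) (∈-allFin x) ([]=⇒lookup x∈p)

elems⁻ : ∀ {n} {p : Subset n} {x} → x ∈ˡ elems p → x ∈ p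
elems⁻ {n} {p} {x} x∈ = lookup⇒[]= x p (proj₂ (∈-filter⁻ (λ y → Vec.lookup p y Bool.≟ true) {xs = allFin n} x∈))

allSubsets-complete : ∀ {n} (p : Subset n) → p ∈ˡ allSubsets n
allSubsets-complete [] = here refl
allSubsets-complete {suc n} (true ∷ p) = ∈-++⁺ˡ (∈-map⁺ (true ∷_) (allSubsets-complete p))
allSubsets-complete {suc n} (false ∷ p) = ∈-++⁺ʳ (map (true ∷_) (allSubsets n)) (∈-map⁺ (false ∷_) (allSubsets-complete p))

x∈⋃⁺ : ∀ {n} {x : Fin n} {p} ps → p ∈ˡ ps → x ∈ p → x ∈ ⋃ ps
x∈⋃⁺ (p ∷ ps) (here refl) x∈p = x∈p∪q⁺ (inj₁ x∈p)
x∈⋃⁺ (q ∷ ps) (there p∈ps) x∈p = x∈p∪q⁺ (inj₂ (x∈⋃⁺ ps p∈ps x∈p))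

x∈⋃⁻ : ∀ {n} {x : Fin n} ps → x ∈ ⋃ ps → ∃ λ p → p ∈ˡ ps × x ∈ p
x∈⋃⁻ [] x∈⊥ = ⊥-elim (∉⊥ x∈⊥)
x∈⋃⁻ (p ∷ ps) x∈ with x∈p∪q⁻ p (⋃ ps) x∈
... | inj₁ x∈p = p , here refl , x∈p
... | inj₂ x∈⋃ps with x∈⋃⁻ ps x∈⋃ps
...   | q , q∈ps , x∈q = q , there q∈ps , x∈q

image⁺ : ∀ {m n} (f : Fin m → Fin n) {e i} → i ∈ e → f i ∈ image f e
image⁺ f {e} {i} i∈e = x∈⋃⁺ (map (λ j → ⁅ f j ⁆) (elems e)) (∈-map⁺ (λ j → ⁅ f j ⁆) (elems⁺ i∈e)) (x∈⁅x⁆ (f i))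

image⁻ : ∀ {m n} (f : Fin m → Fin n) e {y} → y ∈ image f e → ∃ λ i → i ∈ e × f i ≡ y
image⁻ f e y∈ with x∈⋃⁻ (map (λ j → ⁅ f j ⁆) (elems e)) y∈
... | q , q∈ , y∈q with ∈-map⁻ (λ j → ⁅ f j ⁆) q∈
...   | i , i∈ , refl = i , elems⁻ i∈ , sym (x∈⁅y⁆⇒x≡y (f i) y∈q)

∣p∪⁅x⁆∣≡1+∣p∣ : ∀ {n} (p : Subset n) {x} → x ∉ p → ∣ p ∪ ⁅ x ⁆ ∣ ≡ suc ∣ p ∣
∣p∪⁅x⁆∣≡1+∣p∣ (true ∷ p) {fzero} x∉p = contradiction here x∉p
∣p∪⁅x⁆∣≡1+∣p∣ (false ∷ p) {fzero} x∉p = cong (suc ∘ ∣_∣) (∪-identityʳ p)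
∣p∪⁅x⁆∣≡1+∣p∣ (true ∷ p) {fsuc x} x∉p = cong suc (∣p∪⁅x⁆∣≡1+∣p∣ p (x∉p ∘ there))
∣p∪⁅x⁆∣≡1+∣p∣ (false ∷ p) {fsuc x} x∉p = ∣p∪⁅x⁆∣≡1+∣p∣ p (x∉p ∘ there)

∣p∣≡1+∣p-x∣ : ∀ {n} (p : Subset n) {x} → x ∈ p → ∣ p ∣ ≡ suc ∣ p - x ∣
∣p∣≡1+∣p-x∣ (true ∷ p) here = cong (suc ∘ ∣_∣) (sym (p─⊥≡p p))
∣p∣≡1+∣p-x∣ (true ∷ p) (there x∈p) = cong suc (∣p∣≡1+∣p-x∣ p x∈p)
∣p∣≡1+∣p-x∣ (false ∷ p) (there x∈p) = ∣p∣≡1+∣p-x∣ p x∈p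

x∉p-x : ∀ {n} (p : Subset n) x → x ∉ p - x
x∉p-x (b ∷ p) fzero ()
x∉p-x (b ∷ p) (fsuc x) (there x∈) = x∉p-x p x x∈

∣p∣≡1+m⇒Nonempty : ∀ {n} (p : Subset n) {m} → ∣ p ∣ ≡ suc m → Nonempty p
∣p∣≡1+m⇒Nonempty {n} p ∣p∣≡1+m with nonempty? p
... | yes ne = ne
... | no empty = contradiction (trans (sym ∣p∣≡1+m) (trans (cong ∣_∣ (Empty-unique empty)) (∣⊥∣≡0 n))) λ ()

argmax-∈ : ∀ {n} (g : Fin n → ℕ) {p : Subset n} → Nonempty p →
           ∃ λ x → x ∈ p × (∀ {y} → y ∈ p → g y ≤ g x)
argmax-∈ g {p} (x₀ , x₀∈p) = argmax g x₀ (elems p) , argmax∈p , λ y∈p → All.lookup (f[xs]≤f[argmax] x₀ (elems p)) (elems⁺ y∈p)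
  where
  argmax∈p : argmax g x₀ (elems p) ∈ p
  argmax∈p with argmax-sel g x₀ (elems p)
  ... | inj₁ eq = subst (_∈ p) (sym eq) x₀∈p
  ... | inj₂ mem = elems⁻ mem

-- The path lengths d and d_t

least-≤ : ∀ (p : ℕ → Bool) {m ℓ} → T (p ℓ) → ℓ < m → least p m ≤ ℓ
least-≤ p {suc m} {ℓ} pℓ (s≤s ℓ<m) with p zero in p0≡
... | true = z≤n
least-≤ p {suc m} {zero} pℓ _ | false = ⊥-elim (subst T p0≡ pℓ)
least-≤ p {suc m} {suc ℓ} pℓ (s≤s ℓ<m) | false = s≤s (least-≤ (p ∘ suc) pℓ ℓ<m)

dist-≤ : ∀ {n} {B : Subset n} {x ℓ} → x ∈ B → B ⊆ interval x ℓ → ℓ < n → dist B ≤ ℓ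
dist-≤ {B = B} {x} {ℓ} x∈B B⊆I ℓ<n =
  least-≤ (fits B) (any⁺ (λ z → does (B ⊆? interval z ℓ)) (lose (elems⁺ x∈B) (Equivalence.from T-≡ (dec-true (B ⊆? interval x ℓ) B⊆I)))) ℓ<n

distT-≤ : ∀ {n} t {A B : Subset n} → B ⊆ A → ∣ B ∣ ≡ t → distT t A ≤ dist B
distT-≤ {n} t {A} {B} B⊆A ∣B∣≡t =
  foldr-min≤ (∈-filter⁺ (λ C → (C ⊆? A) ×-dec (∣ C ∣ ≟ t)) (allSubsets-complete B) (B⊆A , ∣B∣≡t))
  where
  foldr-min≤ : ∀ {Cs} → B ∈ˡ Cs → foldr (λ C m → dist C ⊓ m) n Cs ≤ dist B
  foldr-min≤ (here refl) = m⊓n≤m _ _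
  foldr-min≤ {C ∷ _} (there B∈Cs) = ≤-trans (m⊓n≤n (dist C) _) (foldr-min≤ B∈Cs)

-- If every point of B is less than D steps before v, then the point of B farthest
-- before v starts a path through all of B that ends at v, of length less than D.
dist<offset : ∀ {n} .{{_ : NonZero n}} {B : Subset n} (v : Fin n) {D} → Nonempty B →
              (∀ {y} → y ∈ B → offset n y v < D) → dist B < D
dist<offset {n} {B} v {D} ne before =
  let x , x∈B , farthest = argmax-∈ (λ y → offset n y v) ne
      B⊆I : B ⊆ interval x (offset n x v)
      B⊆I y∈B = ∈-tabulate⁺ _ (≤⇒≤ᵇ (offset-between x _ v (farthest y∈B)))
  in ≤-<-trans (dist-≤ x∈B B⊆I (offset-< x v)) (before x∈B)

-- Element sums and images

-- Under the shift to the tail, the head contributes 0 and every element of the tail gains 1.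
elementSum : ∀ {n} → Subset n → ℕ
elementSum [] = 0
elementSum (_ ∷ p) = ∣ p ∣ + elementSum p

elementSum-∪⁅⁆ : ∀ {n} (p : Subset n) {x} → x ∉ p → elementSum (p ∪ ⁅ x ⁆) ≡ elementSum p + toℕ x
elementSum-∪⁅⁆ (true ∷ p) {fzero} x∉p = contradiction here x∉p
elementSum-∪⁅⁆ (false ∷ p) {fzero} x∉p =
  trans (cong (λ q → ∣ q ∣ + elementSum q) (∪-identityʳ p)) (sym (+-identityʳ _))
elementSum-∪⁅⁆ (b ∷ p) {fsuc x} x∉p = begin
  ∣ p ∪ ⁅ x ⁆ ∣ + elementSum (p ∪ ⁅ x ⁆)    ≡⟨ cong₂ _+_ (∣p∪⁅x⁆∣≡1+∣p∣ p (x∉p ∘ there)) (elementSum-∪⁅⁆ p (x∉p ∘ there)) ⟩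
  suc ∣ p ∣ + (elementSum p + toℕ x)         ≡⟨ cong suc (+-assoc ∣ p ∣ (elementSum p) (toℕ x)) ⟨
  suc (∣ p ∣ + elementSum p + toℕ x)         ≡⟨ +-suc (∣ p ∣ + elementSum p) (toℕ x) ⟨
  ∣ p ∣ + elementSum p + suc (toℕ x)         ∎
  where open ≡-Reasoning

below : ∀ {m} → ℕ → Subset m
below t = Vec.tabulate (λ j → toℕ j <ᵇ t)

∈-below⁺ : ∀ {m t} {j : Fin m} → toℕ j < t → j ∈ below t
∈-below⁺ j<t = ∈-tabulate⁺ _ (<⇒<ᵇ j<t)

∈-below⁻ : ∀ {m t} {j : Fin m} → j ∈ below t → toℕ j < t
∈-below⁻ {j = j} j∈ = <ᵇ⇒< (toℕ j) _ (∈-tabulate⁻ _ j∈)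

image-∁⁅i⁆∪⁅fi⁆ : ∀ {m n} (f : Fin m → Fin n) i → image f (∁ ⁅ i ⁆) ∪ ⁅ f i ⁆ ≡ image f ⊤
image-∁⁅i⁆∪⁅fi⁆ f i = ⊆-antisym ⊆image-⊤ image-⊤⊆
  where
  ⊆image-⊤ : image f (∁ ⁅ i ⁆) ∪ ⁅ f i ⁆ ⊆ image f ⊤
  ⊆image-⊤ y∈ with x∈p∪q⁻ (image f (∁ ⁅ i ⁆)) ⁅ f i ⁆ y∈
  ... | inj₁ y∈E with image⁻ f (∁ ⁅ i ⁆) y∈E
  ...   | j , _ , refl = image⁺ f ∈⊤
  ⊆image-⊤ y∈ | inj₂ y∈⁅fi⁆ rewrite x∈⁅y⁆⇒x≡y (f i) y∈⁅fi⁆ = image⁺ f ∈⊤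
  image-⊤⊆ : image f ⊤ ⊆ image f (∁ ⁅ i ⁆) ∪ ⁅ f i ⁆
  image-⊤⊆ y∈ with image⁻ f ⊤ y∈
  ... | j , _ , refl with j Fin.≟ i
  ...   | yes refl = x∈p∪q⁺ (inj₂ (x∈⁅x⁆ (f i)))
  ...   | no j≢i = x∈p∪q⁺ (inj₁ (image⁺ f (x∉p⇒x∈∁p (x≢y⇒x∉⁅y⁆ j≢i))))

module _ {m n} {f : Fin m → Fin n} (f-inj : Injective _≡_ _≡_ f) where

  fi∉image-∁⁅i⁆ : ∀ i → f i ∉ image f (∁ ⁅ i ⁆)
  fi∉image-∁⁅i⁆ i fi∈ with image⁻ f (∁ ⁅ i ⁆) fi∈
  ... | j , j∈∁⁅i⁆ , fj≡fi rewrite f-inj fj≡fi = x∈p⇒x∉∁p (x∈⁅x⁆ i) j∈∁⁅i⁆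

  elementSum-image-⊤ : ∀ i → elementSum (image f ⊤) ≡ elementSum (image f (∁ ⁅ i ⁆)) + toℕ (f i)
  elementSum-image-⊤ i = trans (cong elementSum (sym (image-∁⁅i⁆∪⁅fi⁆ f i)))
                               (elementSum-∪⁅⁆ (image f (∁ ⁅ i ⁆)) (fi∉image-∁⁅i⁆ i))

  ∣image-below∣ : ∀ {t} → t ≤ m → ∣ image f (below t) ∣ ≡ t
  ∣image-below∣ {zero} _ = trans (cong ∣_∣ (Empty-unique empty)) (∣⊥∣≡0 n)
    where
    empty : ¬ Nonempty (image f (below 0))
    empty (y , y∈) with image⁻ f (below 0) y∈
    ... | j , j∈ , _ = contradiction (∈-below⁻ {t = 0} j∈) λ ()
  ∣image-below∣ {suc t} t<m = begin
    ∣ image f (below (suc t)) ∣     ≡⟨ cong ∣_∣ (⊆-antisym ⊆step step⊆) ⟩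
    ∣ image f (below t) ∪ ⁅ f j ⁆ ∣ ≡⟨ ∣p∪⁅x⁆∣≡1+∣p∣ (image f (below t)) fj∉ ⟩
    suc ∣ image f (below t) ∣       ≡⟨ cong suc (∣image-below∣ (<⇒≤ t<m)) ⟩
    suc t                           ∎
    where
    open ≡-Reasoning
    j : Fin m
    j = fromℕ< t<m
    fj∉ : f j ∉ image f (below t)
    fj∉ fj∈ with image⁻ f (below t) fj∈
    ... | i , i∈ , fi≡fj rewrite f-inj fi≡fj = <-irrefl (toℕ-fromℕ< t<m) (∈-below⁻ i∈)
    ⊆step : image f (below (suc t)) ⊆ image f (below t) ∪ ⁅ f j ⁆
    ⊆step y∈ with image⁻ f (below (suc t)) y∈
    ... | i , i∈ , refl with m<1+n⇒m<n∨m≡n (∈-below⁻ i∈)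
    ...   | inj₁ i<t = x∈p∪q⁺ (inj₁ (image⁺ f (∈-below⁺ i<t)))
    ...   | inj₂ i≡t = x∈p∪q⁺ (inj₂ (subst (λ z → f z ∈ ⁅ f j ⁆) (sym i≡j) (x∈⁅x⁆ (f j))))
      where
      i≡j : i ≡ j
      i≡j = toℕ-injective (trans i≡t (sym (toℕ-fromℕ< t<m)))
    step⊆ : image f (below t) ∪ ⁅ f j ⁆ ⊆ image f (below (suc t))
    step⊆ y∈ with x∈p∪q⁻ (image f (below t)) ⁅ f j ⁆ y∈
    ... | inj₁ y∈′ with image⁻ f (below t) y∈′
    ...   | i , i∈ , refl = image⁺ f (∈-below⁺ (m<n⇒m<1+n (∈-below⁻ i∈)))
    step⊆ y∈ | inj₂ y∈⁅fj⁆ rewrite x∈⁅y⁆⇒x≡y (f j) y∈⁅fj⁆ =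
      image⁺ f (∈-below⁺ (≤-reflexive (cong suc (toℕ-fromℕ< t<m))))

H-edge-∁⁅j⁆ : ∀ r k (j : Fin (suc r)) → toℕ j < k → H-edge r k (∁ ⁅ j ⁆) ≡ true
H-edge-∁⁅j⁆ r k j j<k = Equivalence.to T-≡ (any⁺ _ (lose (∈-allFin j) (Equivalence.from T-∧ (<⇒<ᵇ j<k , same))))
  where
  same : T (does (≡-dec Bool._≟_ (∁ ⁅ j ⁆) (∁ ⁅ j ⁆)))
  same = Equivalence.from T-≡ (dec-true (≡-dec Bool._≟_ (∁ ⁅ j ⁆) (∁ ⁅ j ⁆)) refl)

does-≟-true : ∀ b → does (b Bool.≟ true) ≡ b
does-≟-true true = refl
does-≟-true false = refl

-- The graphs G c

module Construction (n r k : ℕ) .{{_ : NonZero n}} where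

  isEdge : Fin n → Subset n → Bool
  isEdge c A = (∣ A ∣ ≡ᵇ r) ∧ ((elementSum A + toℕ c) % n ≤ᵇ distT (k ∸ 1) A)

  G : Fin n → RGraph n r
  G c = record
    { edge    = isEdge c
    ; uniform = λ A isEdge≡ → ≡ᵇ⇒≡ ∣ A ∣ r (proj₁ (Equivalence.to T-∧ (Equivalence.from T-≡ isEdge≡)))
    }

  module NoCopy (2≤k : 2 ≤ k) (k≤1+r : k ≤ suc r) (c : Fin n) {f : Fin (suc r) → Fin n}
                (f-inj : Injective _≡_ _≡_ f) (f-hom : ∀ e → H-edge r k e ≡ true → isEdge c (image f e) ≡ true) where

    E : Fin (suc r) → Subset n
    E j = image f (∁ ⁅ j ⁆)

    P : Fin n
    P = (elementSum (image f ⊤) + toℕ c) mod n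

    offset≡ : ∀ j → offset n (f j) P ≡ (elementSum (E j) + toℕ c) % n
    offset≡ j = begin
      offset n (f j) ((elementSum (image f ⊤) + toℕ c) mod n)               ≡⟨ cong (λ s → offset n (f j) ((s + toℕ c) mod n)) (elementSum-image-⊤ f-inj j) ⟩
      offset n (f j) ((elementSum (E j) + toℕ (f j) + toℕ c) mod n)         ≡⟨ cong (λ s → offset n (f j) (s mod n)) (xy∙z≈xz∙y (elementSum (E j)) (toℕ (f j)) (toℕ c)) ⟩
      offset n (f j) ((elementSum (E j) + toℕ c + toℕ (f j)) mod n)         ≡⟨ offset-mod (elementSum (E j) + toℕ c) (f j) ⟩
      (elementSum (E j) + toℕ c) % n                                        ∎
      where open ≡-Reasoning

    offset≤distT : ∀ j → toℕ j < k → offset n (f j) P ≤ distT (k ∸ 1) (E j)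
    offset≤distT j j<k = subst (_≤ distT (k ∸ 1) (E j)) (sym (offset≡ j))
      (≤ᵇ⇒≤ _ _ (proj₂ (Equivalence.to T-∧ (Equivalence.from T-≡ (f-hom (∁ ⁅ j ⁆) (H-edge-∁⁅j⁆ r k j j<k))))))

    farthest : ∃ λ js → js ∈ below k × (∀ {j} → j ∈ below k → offset n (f j) P ≤ offset n (f js) P)
    farthest = argmax-∈ (λ j → offset n (f j) P) (fzero , ∈-below⁺ (≤-trans (s≤s z≤n) 2≤k))

    js : Fin (suc r)
    js = proj₁ farthest

    D : ℕ
    D = offset n (f js) P

    B : Subset n
    B = image f (below k) - f js

    ∣B∣≡k∸1 : ∣ B ∣ ≡ k ∸ 1
    ∣B∣≡k∸1 = cong (_∸ 1) (trans (sym (∣p∣≡1+∣p-x∣ (image f (below k)) (image⁺ f (proj₁ (proj₂ farthest)))))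
                                 (∣image-below∣ f-inj k≤1+r))

    B-preimage : ∀ {y} → y ∈ B → ∃ λ j → toℕ j < k × j ≢ js × f j ≡ y
    B-preimage {y} y∈B =
      let j , j∈ , fj≡y = image⁻ f (below k) (p─q⊆p _ _ y∈B)
      in j , ∈-below⁻ j∈ , (λ j≡js → x∉p-x _ (f js) (subst (_∈ B) (trans (sym fj≡y) (cong f j≡js)) y∈B)) , fj≡y

    B⊆E : B ⊆ E js
    B⊆E y∈B =
      let j , _ , j≢js , fj≡y = B-preimage y∈B
      in subst (_∈ E js) fj≡y (image⁺ f (x∉p⇒x∈∁p (x≢y⇒x∉⁅y⁆ j≢js)))

    B-offset< : ∀ {y} → y ∈ B → offset n y P < D
    B-offset< y∈B =
      let j , j<k , j≢js , fj≡y = B-preimage y∈B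
      in subst (λ y → offset n y P < D) fj≡y
           (≤∧≢⇒< (proj₂ (proj₂ farthest) (∈-below⁺ j<k)) (j≢js ∘ f-inj ∘ offset-injectiveˡ P))

    B-nonempty : Nonempty B
    B-nonempty = ∣p∣≡1+m⇒Nonempty B (trans ∣B∣≡k∸1 (+-∸-assoc 1 2≤k))

    absurd : D < D
    absurd = begin-strict
      D                          ≤⟨ offset≤distT js (∈-below⁻ (proj₁ (proj₂ farthest))) ⟩
      distT (k ∸ 1) (E js)       ≤⟨ distT-≤ (k ∸ 1) B⊆E ∣B∣≡k∸1 ⟩
      dist B                     <⟨ dist<offset P B-nonempty B-offset< ⟩
      D                          ∎
      where open ≤-Reasoning

  G-H-free : 2 ≤ k → k ≤ suc r → ∀ c → ¬ Contains (G c) (H-edge r k)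
  G-H-free 2≤k k≤1+r c (f , f-inj , f-hom) = <-irrefl refl (NoCopy.absurd 2≤k k≤1+r c f-inj f-hom)

  numEdges≡ : ∀ c → numEdges (G c) ≡ sum (map (indicator ∘ isEdge c) (allSubsets n))
  numEdges≡ c = trans (length-filter≡sum-indicator (λ A → isEdge c A Bool.≟ true) (allSubsets n))
                      (sum-cong (cong indicator ∘ does-≟-true ∘ isEdge c) (allSubsets n))

  count-per-set : ∀ {q} → q < n → (A : Subset n) →
                  sum (map (λ d → indicator ((∣ A ∣ ≡ᵇ r) ∧ (d ≤ᵇ distT (k ∸ 1) A))) (upTo (suc q)))
                  ≤ sum (map (λ c → indicator (isEdge c A)) (allFin n))
  count-per-set {q} q<n A with ∣ A ∣ ≡ᵇ r
  ... | false = ≤-trans (≤-reflexive (sum-zeros (upTo (suc q)))) z≤n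
  ... | true = begin
    sum (map (λ d → indicator (d ≤ᵇ D)) (upTo (suc q)))          ≡⟨ sum-upTo (λ d → indicator (d ≤ᵇ D)) (suc q) ⟩
    sumBelow (suc q) (λ d → indicator (d ≤ᵇ D))                   ≤⟨ sumBelow-monoˡ-≤ (λ d → indicator (d ≤ᵇ D)) q<n ⟩
    sumBelow n (λ d → indicator (d ≤ᵇ D))                         ≡⟨ sumBelow-cong n (λ d d<n → cong (λ x → indicator (x ≤ᵇ D)) (m<n⇒m%n≡m d<n)) ⟨
    sumBelow n F                                                  ≡⟨ sumBelow-periodic n F (λ x → cong (λ y → indicator (y ≤ᵇ D)) ([m+n]%n≡m%n x n)) (elementSum A) ⟨
    sumBelow n (λ c → F (elementSum A + c))                       ≡⟨ sum-allFin (λ c → F (elementSum A + c)) n ⟨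
    sum (map (λ c → F (elementSum A + toℕ c)) (allFin n))         ∎
    where
    open ≤-Reasoning
    D : ℕ
    D = distT (k ∸ 1) A
    F : ℕ → ℕ
    F x = indicator (x % n ≤ᵇ D)

  N-sum≤edge-sum : ∀ {q} → q < n → sum (map (N n r (k ∸ 1)) (upTo (suc q))) ≤ sum (map (numEdges ∘ G) (allFin n))
  N-sum≤edge-sum {q} q<n = begin
    sum (map (N n r (k ∸ 1)) (upTo (suc q)))                               ≡⟨ sum-cong (λ d → length-filter≡sum-indicator _ (allSubsets n)) (upTo (suc q)) ⟩
    sum (map (λ d → sum (map (λ A → countedInN d A) (allSubsets n))) (upTo (suc q))) ≡⟨ sum-swap countedInN (upTo (suc q)) (allSubsets n) ⟩
    sum (map (λ A → sum (map (λ d → countedInN d A) (upTo (suc q)))) (allSubsets n)) ≤⟨ sum-mono-≤ (count-per-set q<n) (allSubsets n) ⟩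
    sum (map (λ A → sum (map (λ c → edgeIndicator c A) (allFin n))) (allSubsets n)) ≡⟨ sum-swap edgeIndicator (allFin n) (allSubsets n) ⟨
    sum (map (λ c → sum (map (edgeIndicator c) (allSubsets n))) (allFin n))       ≡⟨ sum-cong numEdges≡ (allFin n) ⟨
    sum (map (numEdges ∘ G) (allFin n))                                   ∎
    where
    open ≤-Reasoning
    countedInN : ℕ → Subset n → ℕ
    countedInN d A = indicator ((∣ A ∣ ≡ᵇ r) ∧ (d ≤ᵇ distT (k ∸ 1) A))
    edgeIndicator : Fin n → Subset n → ℕ
    edgeIndicator c A = indicator (isEdge c A)

  largest-graph : ∃ λ c → sum (map (numEdges ∘ G) (allFin n)) ≤ n * numEdges (G c)
  largest-graph =
    let c , _ , largest = argmax-∈ (numEdges ∘ G) {⊤} (0 mod n , ∈⊤)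
    in c , subst (λ m → sum (map (numEdges ∘ G) (allFin n)) ≤ m * numEdges (G c))
                 (length-tabulate {n = n} (λ x → x)) (sum≤length*bound (allFin n) (λ _ → largest ∈⊤))

[k∸2]*n/r<n : ∀ n r k .{{_ : NonZero n}} .{{_ : NonZero r}} → k ≤ suc r → (k ∸ 2) * n / r < n
[k∸2]*n/r<n n r@(suc _) k k≤1+r = m<n*o⇒m/o<n (begin-strict
  (k ∸ 2) * n  ≡⟨ *-comm (k ∸ 2) n ⟩
  n * (k ∸ 2)  <⟨ *-monoʳ-< n (s≤s (∸-monoˡ-≤ 2 k≤1+r)) ⟩
  n * r        ∎)
  where open ≤-Reasoning

corollary8 : (n r k : ℕ) → 3 ≤ n → 2 ≤ k → k ≤ suc r → r ≤ n → .{{_ : NonZero r}} →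
    ∃ λ (G : RGraph n r) → (¬ Contains G (H-edge r k)) ×
      (sum (map (λ d → N n r (k ∸ 1) d) (upTo (suc (((k ∸ 2) * n) / r)))) ≤ n * numEdges G)
corollary8 n@(suc _) r k _ 2≤k k≤1+r _ =
  let c , average = largest-graph in
  G c , G-H-free 2≤k k≤1+r c , ≤-trans (N-sum≤edge-sum ([k∸2]*n/r<n n r k k≤1+r)) average
  where open Construction n r k
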